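{- For any integer $n\ge3$, $\gamma_{(2,2,0)}(P_n)=\gamma_{(2,2,0)}(C_n)=2\lceil n/3\rceil$, where $P_n$ and $C_n$ are the path and cycle of order $n$.
   Context: $N(v)$ is the open neighbourhood and $f(S)=\sum_{u\in S}f(u)$. $\gamma_{(2,2,0)}(G)$ is the minimum of $\sum_v f(v)$ over functions $f:V(G)\to\{0,1,2\}$ such that $f(N(v))\ge2$ whenever $f(v)\in\{0,1\}$ (no condition when $f(v)=2$). -}

module Defs where

open import Data.Nat using (ℕ; zero; suc; _+_; _*_; _≤_; _≥_; _≡ᵇ_)
open import Data.Nat.DivMod using (_/_)
open import Data.Nat.ListAction using (sum)
open import Data.Bool using (Bool; true; false; if_then_else_; _∨_; _∧_)
open import Data.Fin using (Fin; toℕ)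
open import Data.List using (List; map)
open import Data.List using () renaming (allFin to allFinL)
open import Relation.Binary.PropositionalEquality using (_≡_)
open import Data.Product using (Σ; _×_; _,_)

Graph : ℕ → Set
Graph n = Fin n → Fin n → Bool

pathGraph : (n : ℕ) → Graph n
pathGraph n i j = (suc (toℕ i) ≡ᵇ toℕ j) ∨ (suc (toℕ j) ≡ᵇ toℕ i)

-- Cycle C_n (intended for n ≥ 3): path edges plus the edge {0, n-1}.
cycleGraph : (n : ℕ) → Graph n
cycleGraph n i j = pathGraph n i j
  ∨ ((toℕ i ≡ᵇ 0) ∧ (suc (toℕ j) ≡ᵇ n))
  ∨ ((toℕ j ≡ᵇ 0) ∧ (suc (toℕ i) ≡ᵇ n))

Label : ℕ → Set
Label n = Fin n → Fin 3

val : ∀ {n} → Label n → Fin n → ℕ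
val f v = toℕ (f v)

nbhdSum : ∀ {n} → Graph n → Label n → Fin n → ℕ
nbhdSum {n} G f v = sum (map (λ u → if G v u then val f u else 0) (allFinL n))

weight : ∀ {n} → Label n → ℕ
weight {n} f = sum (map (val f) (allFinL n))

Is220 : ∀ {n} → Graph n → Label n → Set
Is220 G f = ∀ v → val f v ≤ 1 → nbhdSum G f v ≥ 2

Gamma220≡ : ∀ {n} → Graph n → ℕ → Set
Gamma220≡ G k =
  (Σ (Label _) λ f → Is220 G f × weight f ≡ k)
  × (∀ f → Is220 G f → k ≤ weight f)

ceil3 : ℕ → ℕ
ceil3 n = (n + 2) / 3

-- Upper bound: put 2 on every third vertex of the path, in the phase that also
-- covers the last vertex; this labelling works on the cycle as well.
-- Lower bound: read a (2,2,0)-function on C_n as an n-periodic sequence x.  Every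
-- window x i + x (i+1) + x (i+2) is at least 2: either the middle value is 2, or
-- it is at most 1 and then its two neighbours sum to at least 2.  If some value
-- is 2, read the cycle starting there and split it into blocks of three preceded
-- by a shorter block (when 3 ∤ n) beginning with that 2: each block contributes at
-- least 2, giving 2⌈n/3⌉.  Otherwise all values are at most 1, hence all are
-- exactly 1, and the weight is n ≥ 2⌈n/3⌉.
module Submission where

open import Defs
open import Data.Nat using (ℕ; zero; suc; _+_; _*_; _≤_; _<_; _≡ᵇ_; z≤n; s≤s; NonZero; _≟_)
open import Data.Nat.Properties
open import Data.Nat.DivMod using (_%_; _mod_; m/n≡1+[m∸n]/n; m<n⇒m%n≡m; n%n≡0; m%n%n≡m%n; [m+n]%n≡m%n; %-distribˡ-+)
open import Data.Nat.ListAction using (sum)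
open import Data.Bool using (true; false; if_then_else_; T)
open import Data.Bool.Properties using (T-∨; T-∧)
open import Data.Fin using (Fin; toℕ; fromℕ<)
open import Data.Fin.Properties using (toℕ-fromℕ<; toℕ<n; toℕ≤pred[n]; toℕ-injective; any?)
open import Data.List using (tabulate)
open import Data.List.Properties using (map-tabulate)
open import Data.Product using (_×_; _,_; ∃)
open import Data.Sum using (_⊎_; inj₁; inj₂)
open import Data.Empty using (⊥-elim)
open import Function using (_∘_)
open import Function.Bundles using (Equivalence)
open import Relation.Nullary using (yes; no; ¬_)
open import Relation.Binary.PropositionalEquality
open import Algebra.Properties.CommutativeSemigroup +-commutativeSemigroup using (interchange)

open Equivalence using (to; from)

sum-tabulate-mono : ∀ {n} {g h : Fin n → ℕ} → (∀ u → g u ≤ h u) → sum (tabulate g) ≤ sum (tabulate h)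
sum-tabulate-mono {zero}  le = z≤n
sum-tabulate-mono {suc n} le = +-mono-≤ (le Fin.zero) (sum-tabulate-mono (le ∘ Fin.suc))

≤-sum-tabulate : ∀ {n} (g : Fin n → ℕ) u → g u ≤ sum (tabulate g)
≤-sum-tabulate g Fin.zero    = m≤m+n _ _
≤-sum-tabulate g (Fin.suc u) = ≤-trans (≤-sum-tabulate (g ∘ Fin.suc) u) (m≤n+m _ _)

sum-tabulate-+ : ∀ {n} (g h : Fin n → ℕ) →
  sum (tabulate (λ u → g u + h u)) ≡ sum (tabulate g) + sum (tabulate h)
sum-tabulate-+ {zero}  g h = refl
sum-tabulate-+ {suc n} g h =
  trans (cong (g Fin.zero + h Fin.zero +_) (sum-tabulate-+ (g ∘ Fin.suc) (h ∘ Fin.suc)))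
        (interchange (g Fin.zero) (h Fin.zero) _ _)

sum-tabulate-indicator : ∀ {n} (g : Fin n → ℕ) p →
  sum (tabulate (λ u → if toℕ u ≡ᵇ toℕ p then g u else 0)) ≡ g p
sum-tabulate-indicator {suc n} g Fin.zero =
  trans (cong (g Fin.zero +_) (sum-tabulate-zero n)) (+-identityʳ _)
  where
  sum-tabulate-zero : ∀ n → sum (tabulate {n = n} (λ _ → 0)) ≡ 0
  sum-tabulate-zero zero    = refl
  sum-tabulate-zero (suc n) = sum-tabulate-zero n
sum-tabulate-indicator g (Fin.suc p) = sum-tabulate-indicator (g ∘ Fin.suc) p

label≤1 : (c : Fin 3) → ¬ toℕ c ≡ 2 → toℕ c ≤ 1
label≤1 Fin.zero                       _  = z≤n
label≤1 (Fin.suc Fin.zero)             _  = s≤s z≤n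
label≤1 (Fin.suc (Fin.suc Fin.zero))   ≢2 = ⊥-elim (≢2 refl)

module _ {n} (G : Graph n) (f : Label n) where

  nbhdSum≡ : ∀ v → nbhdSum G f v ≡ sum (tabulate (λ u → if G v u then val f u else 0))
  nbhdSum≡ v = cong sum (map-tabulate (λ u → u) (λ u → if G v u then val f u else 0))

  ≤-nbhdSum : ∀ {v w} → T (G v w) → val f w ≤ nbhdSum G f v
  ≤-nbhdSum {v} {w} vw with G v w | ≤-sum-tabulate (λ u → if G v u then val f u else 0) w
  ... | true | le = subst (val f w ≤_) (sym (nbhdSum≡ v)) le

  2≤nbhdSum : ∀ {v w} → T (G v w) → val f w ≡ 2 → 2 ≤ nbhdSum G f v
  2≤nbhdSum vw fw≡2 = subst (_≤ _) fw≡2 (≤-nbhdSum vw)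

  nbhdSum-≤ : ∀ {v} p q → (∀ u → T (G v u) → u ≡ p ⊎ u ≡ q) → nbhdSum G f v ≤ val f p + val f q
  nbhdSum-≤ {v} p q adj = begin
    nbhdSum G f v                                          ≡⟨ nbhdSum≡ v ⟩
    sum (tabulate (λ u → if G v u then val f u else 0))    ≤⟨ sum-tabulate-mono term-≤ ⟩
    sum (tabulate (λ u → onlyAt p u + onlyAt q u))         ≡⟨ sum-tabulate-+ (onlyAt p) (onlyAt q) ⟩
    sum (tabulate (onlyAt p)) + sum (tabulate (onlyAt q))  ≡⟨ cong₂ _+_ (sum-tabulate-indicator (val f) p)
                                                                        (sum-tabulate-indicator (val f) q) ⟩
    val f p + val f q                                      ∎
    where
    open ≤-Reasoning
    onlyAt : Fin n → Fin n → ℕ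
    onlyAt p u = if toℕ u ≡ᵇ toℕ p then val f u else 0
    onlyAt-self : ∀ {p u} → u ≡ p → onlyAt p u ≡ val f u
    onlyAt-self {p} {u} refl with toℕ u ≡ᵇ toℕ u | ≡⇒≡ᵇ (toℕ u) (toℕ u) refl
    ... | true | _ = refl
    term-≤ : ∀ u → (if G v u then val f u else 0) ≤ onlyAt p u + onlyAt q u
    term-≤ u with G v u in e
    ... | false = z≤n
    ... | true with adj u (subst T (sym e) _)
    ...   | inj₁ u≡p = ≤-trans (≤-reflexive (sym (onlyAt-self u≡p))) (m≤m+n _ _)
    ...   | inj₂ u≡q = ≤-trans (≤-reflexive (sym (onlyAt-self u≡q))) (m≤n+m _ _)

weight≡sum-tabulate : ∀ {n} (f : Label n) → weight f ≡ sum (tabulate (val f))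
weight≡sum-tabulate f = cong sum (map-tabulate (λ u → u) (val f))

nbhdSum-mono : ∀ {n} {G H : Graph n} (f : Label n) v → (∀ u → T (G v u) → T (H v u)) →
  nbhdSum G f v ≤ nbhdSum H f v
nbhdSum-mono {G = G} {H} f v sub = begin
  nbhdSum G f v                                         ≡⟨ nbhdSum≡ G f v ⟩
  sum (tabulate (λ u → if G v u then val f u else 0))   ≤⟨ sum-tabulate-mono term-≤ ⟩
  sum (tabulate (λ u → if H v u then val f u else 0))   ≡⟨ nbhdSum≡ H f v ⟨
  nbhdSum H f v                                         ∎
  where
  open ≤-Reasoning
  term-≤ : ∀ u → (if G v u then val f u else 0) ≤ (if H v u then val f u else 0)
  term-≤ u with G v u | H v u | sub u
  ... | false | _     | _  = z≤n
  ... | true  | true  | _  = ≤-refl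
  ... | true  | false | gh = ⊥-elim (gh _)

sumFrom : (ℕ → ℕ) → ℕ → ℕ → ℕ
sumFrom x s zero    = 0
sumFrom x s (suc n) = x s + sumFrom x (suc s) n

sum-tabulate≡sumFrom : ∀ {n} (g : Fin n → ℕ) (x : ℕ → ℕ) s →
  (∀ u → g u ≡ x (toℕ u + s)) → sum (tabulate g) ≡ sumFrom x s n
sum-tabulate≡sumFrom {zero}  g x s eq = refl
sum-tabulate≡sumFrom {suc n} g x s eq =
  cong₂ _+_ (eq Fin.zero)
            (sum-tabulate≡sumFrom (g ∘ Fin.suc) x (suc s) λ u →
               trans (eq (Fin.suc u)) (cong x (sym (+-suc (toℕ u) s))))

sumFrom-+ : ∀ x s m n → sumFrom x s (m + n) ≡ sumFrom x s m + sumFrom x (s + m) n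
sumFrom-+ x s zero    n = cong (λ t → sumFrom x t n) (sym (+-identityʳ s))
sumFrom-+ x s (suc m) n = begin
  x s + sumFrom x (suc s) (m + n)                            ≡⟨ cong (x s +_) (sumFrom-+ x (suc s) m n) ⟩
  x s + (sumFrom x (suc s) m + sumFrom x (suc s + m) n)      ≡⟨ +-assoc (x s) _ _ ⟨
  x s + sumFrom x (suc s) m + sumFrom x (suc s + m) n        ≡⟨ cong (λ t → x s + sumFrom x (suc s) m + sumFrom x t n) (+-suc s m) ⟨
  x s + sumFrom x (suc s) m + sumFrom x (s + suc m) n        ∎
  where open ≡-Reasoning

≤-sumFrom : ∀ x s n → x s ≤ sumFrom x s (suc n)
≤-sumFrom x s n = m≤m+n (x s) _

length≤sumFrom : ∀ x s n → (∀ i → 1 ≤ x i) → n ≤ sumFrom x s n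
length≤sumFrom x s zero    pos = z≤n
length≤sumFrom x s (suc n) pos = +-mono-≤ (pos s) (length≤sumFrom x (suc s) n pos)

sumFrom-shift-period : ∀ x k s n → (∀ i → x (i + k) ≡ x i) → sumFrom x (s + k) n ≡ sumFrom x s n
sumFrom-shift-period x k s zero    per = refl
sumFrom-shift-period x k s (suc n) per = cong₂ _+_ (per s) (sumFrom-shift-period x k (suc s) n per)

sumFrom-rotate : ∀ x n s → (∀ i → x (i + n) ≡ x i) → sumFrom x s n ≡ sumFrom x 0 n
sumFrom-rotate x n zero    per = refl
sumFrom-rotate x n (suc s) per = trans (+-cancelˡ-≡ (x s) _ _ step) (sumFrom-rotate x n s per)
  where
  open ≡-Reasoning
  step : x s + sumFrom x (suc s) n ≡ x s + sumFrom x s n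
  step = begin
    sumFrom x s (1 + n)                   ≡⟨ cong (sumFrom x s) (+-comm 1 n) ⟩
    sumFrom x s (n + 1)                   ≡⟨ sumFrom-+ x s n 1 ⟩
    sumFrom x s n + (x (s + n) + 0)       ≡⟨ cong (λ t → sumFrom x s n + t) (trans (+-identityʳ _) (per s)) ⟩
    sumFrom x s n + x s                   ≡⟨ +-comm _ (x s) ⟩
    x s + sumFrom x s n                   ∎

ceil3-+3 : ∀ m → ceil3 (3 + m) ≡ suc (ceil3 m)
ceil3-+3 m = m/n≡1+[m∸n]/n {3 + m + 2} {3} (s≤s (s≤s (s≤s z≤n)))

2*ceil3-+3 : ∀ m → 2 * ceil3 (3 + m) ≡ 2 + 2 * ceil3 m
2*ceil3-+3 m = trans (cong (2 *_) (ceil3-+3 m)) (*-suc 2 (ceil3 m))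

module _ (x : ℕ → ℕ) where

  window≥2 : (∀ i → x i ≤ 2) → (∀ i → x (suc i) ≤ 1 → 2 ≤ x i + x (suc (suc i))) →
    ∀ s → 2 ≤ sumFrom x s 3
  window≥2 bounded cond s with m≤n⇒m<n∨m≡n (bounded (suc s))
  ... | inj₁ (s≤s middle≤1) = begin
    2                                     ≤⟨ cond s middle≤1 ⟩
    x s + x (2 + s)                       ≤⟨ +-monoʳ-≤ (x s) (m≤n+m _ _) ⟩
    x s + (x (1 + s) + x (2 + s))         ≡⟨ cong (λ t → x s + (x (1 + s) + t)) (+-identityʳ _) ⟨
    sumFrom x s 3                         ∎
    where open ≤-Reasoning
  ... | inj₂ middle≡2 =
    ≤-trans (≤-reflexive (sym middle≡2)) (≤-trans (≤-sumFrom x (1 + s) 1) (m≤n+m _ (x s)))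

  2*ceil3≤sumFrom : (∀ s → 2 ≤ sumFrom x s 3) → ∀ {s} → 2 ≤ x s → ∀ m → 2 * ceil3 m ≤ sumFrom x s m
  2*ceil3≤sumFrom window xs≥2 0 = z≤n
  2*ceil3≤sumFrom window xs≥2 1 = ≤-trans xs≥2 (≤-sumFrom x _ 0)
  2*ceil3≤sumFrom window xs≥2 2 = ≤-trans xs≥2 (≤-sumFrom x _ 1)
  2*ceil3≤sumFrom window {s} xs≥2 (suc (suc (suc m))) = begin
    2 * ceil3 (3 + m)                      ≡⟨ 2*ceil3-+3 m ⟩
    2 + 2 * ceil3 m                        ≤⟨ +-mono-≤ (window (s + m)) (2*ceil3≤sumFrom window xs≥2 m) ⟩
    sumFrom x (s + m) 3 + sumFrom x s m    ≡⟨ +-comm (sumFrom x (s + m) 3) _ ⟩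
    sumFrom x s m + sumFrom x (s + m) 3    ≡⟨ sumFrom-+ x s m 3 ⟨
    sumFrom x s (m + 3)                    ≡⟨ cong (sumFrom x s) (+-comm m 3) ⟩
    sumFrom x s (3 + m)                    ∎
    where open ≤-Reasoning

  2*ceil3≤sumFrom-periodic : ∀ n → (∀ i → x (i + n) ≡ x i) → (∀ s → 2 ≤ sumFrom x s 3) →
    ∀ {s} → 2 ≤ x s → 2 * ceil3 n ≤ sumFrom x 0 n
  2*ceil3≤sumFrom-periodic n periodic window {s} xs≥2 =
    subst (2 * ceil3 n ≤_) (sumFrom-rotate x n s periodic) (2*ceil3≤sumFrom window xs≥2 n)

2*ceil3≤ : ∀ {n} → 3 ≤ n → 2 * ceil3 n ≤ n
2*ceil3≤ {suc (suc (suc m))} (s≤s (s≤s (s≤s _))) = go m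
  where
  go : ∀ m → 2 * ceil3 (3 + m) ≤ 3 + m
  go 0 = n≤1+n 2
  go 1 = ≤-refl
  go 2 = n≤1+n 4
  go (suc (suc (suc m))) = begin
    2 * ceil3 (3 + (3 + m))   ≡⟨ 2*ceil3-+3 (3 + m) ⟩
    2 + 2 * ceil3 (3 + m)     ≤⟨ +-monoʳ-≤ 2 (go m) ⟩
    2 + (3 + m)               ≤⟨ n≤1+n _ ⟩
    3 + (3 + m)               ∎
    where open ≤-Reasoning

module _ {n : ℕ} .{{_ : NonZero n}} where

  next : Fin n → Fin n
  next v = suc (toℕ v) mod n

  toℕ-mod : ∀ i → toℕ (i mod n) ≡ i % n
  toℕ-mod i = toℕ-fromℕ< _

  mod-toℕ : ∀ u → toℕ u mod n ≡ u
  mod-toℕ u = toℕ-injective (trans (toℕ-mod (toℕ u)) (m<n⇒m%n≡m (toℕ<n u)))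

  suc%≡0 : ∀ {a} → suc a ≡ n → suc a % n ≡ 0
  suc%≡0 e = trans (cong (_% n) e) (n%n≡0 n)

  suc-%-injective : ∀ {a b} → a < n → b < n → suc a % n ≡ suc b % n → a ≡ b
  suc-%-injective a<n b<n e with m≤n⇒m<n∨m≡n a<n | m≤n⇒m<n∨m≡n b<n
  ... | inj₁ a+1<n | inj₁ b+1<n = suc-injective (trans (sym (m<n⇒m%n≡m a+1<n)) (trans e (m<n⇒m%n≡m b+1<n)))
  ... | inj₁ a+1<n | inj₂ b+1≡n = ⊥-elim (1+n≢0 (trans (sym (m<n⇒m%n≡m a+1<n)) (trans e (suc%≡0 b+1≡n))))
  ... | inj₂ a+1≡n | inj₁ b+1<n = ⊥-elim (1+n≢0 (trans (sym (m<n⇒m%n≡m b+1<n)) (trans (sym e) (suc%≡0 a+1≡n))))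
  ... | inj₂ a+1≡n | inj₂ b+1≡n = suc-injective (trans a+1≡n (sym b+1≡n))

  next-injective : ∀ {u v} → next u ≡ next v → u ≡ v
  next-injective {u} {v} e = toℕ-injective (suc-%-injective (toℕ<n u) (toℕ<n v)
    (trans (sym (toℕ-mod _)) (trans (cong toℕ e) (toℕ-mod _))))

  next-mod : ∀ i → next (i mod n) ≡ suc i mod n
  next-mod i = toℕ-injective (begin
    toℕ (next (i mod n))          ≡⟨ toℕ-mod _ ⟩
    suc (toℕ (i mod n)) % n       ≡⟨ cong (λ t → suc t % n) (toℕ-mod i) ⟩
    (1 + i % n) % n               ≡⟨ %-distribˡ-+ 1 (i % n) n ⟩
    (1 % n + i % n % n) % n       ≡⟨ cong (λ t → (1 % n + t) % n) (m%n%n≡m%n i n) ⟩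
    (1 % n + i % n) % n           ≡⟨ %-distribˡ-+ 1 i n ⟨
    suc i % n                     ≡⟨ toℕ-mod (suc i) ⟨
    toℕ (suc i mod n)             ∎)
    where open ≡-Reasoning

  ≡next : ∀ {a b} → suc (toℕ a) % n ≡ toℕ b → b ≡ next a
  ≡next e = toℕ-injective (trans (sym e) (sym (toℕ-mod _)))

  ≡next-step : ∀ {a b} → suc (toℕ a) ≡ toℕ b → b ≡ next a
  ≡next-step {b = b} e = ≡next (trans (cong (_% n) e) (m<n⇒m%n≡m (toℕ<n b)))

  ≡next-wrap : ∀ {a b} → suc (toℕ a) ≡ n → toℕ b ≡ 0 → b ≡ next a
  ≡next-wrap a+1≡n b≡0 = ≡next (trans (suc%≡0 a+1≡n) (sym b≡0))

  cycle-adjacent : ∀ {v u} → T (cycleGraph n v u) → u ≡ next v ⊎ v ≡ next u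
  cycle-adjacent {v} {u} adj with to T-∨ adj
  ... | inj₁ path-edge with to T-∨ path-edge
  ...   | inj₁ v+1≡u = inj₁ (≡next-step (≡ᵇ⇒≡ _ _ v+1≡u))
  ...   | inj₂ u+1≡v = inj₂ (≡next-step (≡ᵇ⇒≡ _ _ u+1≡v))
  cycle-adjacent {v} {u} adj | inj₂ closing-edge with to T-∨ closing-edge
  ...   | inj₁ v≡0∧u+1≡n = let (v≡0 , u+1≡n) = to T-∧ v≡0∧u+1≡n in
                           inj₂ (≡next-wrap (≡ᵇ⇒≡ _ _ u+1≡n) (≡ᵇ⇒≡ _ _ v≡0))
  ...   | inj₂ u≡0∧v+1≡n = let (u≡0 , v+1≡n) = to T-∧ u≡0∧v+1≡n in
                           inj₁ (≡next-wrap (≡ᵇ⇒≡ _ _ v+1≡n) (≡ᵇ⇒≡ _ _ u≡0))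

  cycle-neighbours : ∀ i {u} → T (cycleGraph n (suc i mod n) u) → u ≡ i mod n ⊎ u ≡ suc (suc i) mod n
  cycle-neighbours i adj with cycle-adjacent adj
  ... | inj₁ u≡next = inj₂ (trans u≡next (next-mod (suc i)))
  ... | inj₂ e      = inj₁ (next-injective (sym (trans (next-mod i) e)))

  readCycle : Label n → ℕ → ℕ
  readCycle f i = val f (i mod n)

  module _ (f : Label n) where

    readCycle-periodic : ∀ i → readCycle f (i + n) ≡ readCycle f i
    readCycle-periodic i = cong (val f) (toℕ-injective (begin
      toℕ ((i + n) mod n)   ≡⟨ toℕ-mod (i + n) ⟩
      (i + n) % n           ≡⟨ [m+n]%n≡m%n i n ⟩
      i % n                 ≡⟨ toℕ-mod i ⟨
      toℕ (i mod n)         ∎))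
      where open ≡-Reasoning

    weight≡sumFrom : weight f ≡ sumFrom (readCycle f) 0 n
    weight≡sumFrom = trans (weight≡sum-tabulate f) (sum-tabulate≡sumFrom (val f) (readCycle f) 0 λ u →
      cong (val f) (sym (trans (cong (_mod n) (+-identityʳ _)) (mod-toℕ u))))

    readCycle-220 : Is220 (cycleGraph n) f → ∀ i → readCycle f (suc i) ≤ 1 →
      2 ≤ readCycle f i + readCycle f (suc (suc i))
    readCycle-220 is220 i le = ≤-trans (is220 _ le) (nbhdSum-≤ (cycleGraph n) f _ _ (λ u → cycle-neighbours i))

    cycle-lower : 3 ≤ n → Is220 (cycleGraph n) f → 2 * ceil3 n ≤ weight f
    cycle-lower 3≤n is220 = subst (2 * ceil3 n ≤_) (sym weight≡sumFrom) bound
      where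
      x : ℕ → ℕ
      x = readCycle f
      bound : 2 * ceil3 n ≤ sumFrom x 0 n
      bound with any? (λ u → val f u ≟ 2)
      ... | yes (u , fu≡2) = 2*ceil3≤sumFrom-periodic x n readCycle-periodic window (≤-reflexive (sym x[u]≡2))
        where
        window : ∀ s → 2 ≤ sumFrom x s 3
        window = window≥2 x (λ i → toℕ≤pred[n] (f (i mod n))) (readCycle-220 is220)
        x[u]≡2 : x (toℕ u) ≡ 2
        x[u]≡2 = trans (cong (val f) (mod-toℕ u)) fu≡2
      ... | no ∄2 = ≤-trans (2*ceil3≤ 3≤n) (length≤sumFrom x 0 n x≥1)
        where
        x≤1 : ∀ i → x i ≤ 1
        x≤1 i = label≤1 (f (i mod n)) (λ fi≡2 → ∄2 (i mod n , fi≡2))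
        x≥1 : ∀ i → 1 ≤ x i
        x≥1 i = +-cancelʳ-≤ 1 1 (x i)
          (≤-trans (readCycle-220 is220 i (x≤1 (suc i))) (+-monoʳ-≤ (x i) (x≤1 (suc (suc i)))))

stripe : ℕ → ℕ → Fin 3
stripe o i = if i % 3 ≡ᵇ o then Fin.suc (Fin.suc Fin.zero) else Fin.zero

-- The stripes start at vertex 1, except for n ≡ 1 (mod 3), where they start at 0
-- so that the last vertex n - 1 carries a 2.
phase : ℕ → ℕ
phase n = if n % 3 ≡ᵇ 1 then 0 else 1

phase≤1 : ∀ n → phase n ≤ 1
phase≤1 n with n % 3 ≡ᵇ 1
... | true  = z≤n
... | false = ≤-refl

stripe-periodic : ∀ o i → toℕ (stripe o (i + 3)) ≡ toℕ (stripe o i)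
stripe-periodic o i with (i + 3) % 3 | [m+n]%n≡m%n i 3
... | _ | refl = refl

stripe-gap : ∀ o → o ≤ 1 → ∀ i → toℕ (stripe o i) ≤ 1 →
  toℕ (stripe o (suc i)) ≡ 2 ⊎ ∃ λ j → suc j ≡ i × toℕ (stripe o j) ≡ 2
stripe-gap (suc (suc _)) (s≤s ()) _ _
stripe-gap 0 _ 1 _ = inj₂ (0 , refl , refl)
stripe-gap 0 _ 2 _ = inj₁ refl
stripe-gap 1 _ 0 _ = inj₁ refl
stripe-gap 1 _ 2 _ = inj₂ (1 , refl , refl)
stripe-gap 0 _ 0 (s≤s ())
stripe-gap 1 _ 1 (s≤s ())
stripe-gap o o≤1 (suc (suc (suc i))) le with stripe-gap o o≤1 i le
... | inj₁ e             = inj₁ e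
... | inj₂ (j , refl , e) = inj₂ (3 + j , refl , e)

stripe-phase-end : ∀ n → toℕ (stripe (phase n) n) ≡ 0
stripe-phase-end 0 = refl
stripe-phase-end 1 = refl
stripe-phase-end 2 = refl
stripe-phase-end (suc (suc (suc n))) = stripe-phase-end n

sumFrom-stripe : ∀ n → sumFrom (toℕ ∘ stripe (phase n)) 0 n ≡ 2 * ceil3 n
sumFrom-stripe 0 = refl
sumFrom-stripe 1 = refl
sumFrom-stripe 2 = refl
sumFrom-stripe (suc (suc (suc n))) = begin
  g 0 + (g 1 + (g 2 + sumFrom g 3 n))   ≡⟨ first-block (phase≤1 n) ⟩
  2 + sumFrom g (0 + 3) n               ≡⟨ cong (2 +_) (sumFrom-shift-period g 3 0 n (stripe-periodic (phase n))) ⟩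
  2 + sumFrom g 0 n                     ≡⟨ cong (2 +_) (sumFrom-stripe n) ⟩
  2 + 2 * ceil3 n                       ≡⟨ 2*ceil3-+3 n ⟨
  2 * ceil3 (3 + n)                     ∎
  where
  open ≡-Reasoning
  g : ℕ → ℕ
  g = toℕ ∘ stripe (phase n)
  first-block : ∀ {o w} → o ≤ 1 →
    toℕ (stripe o 0) + (toℕ (stripe o 1) + (toℕ (stripe o 2) + w)) ≡ 2 + w
  first-block {suc (suc _)} (s≤s ())
  first-block {0} _ = refl
  first-block {1} _ = refl

stripes : (n : ℕ) → Label n
stripes n v = stripe (phase n) (toℕ v)

path-edge : ∀ {n} {v w : Fin n} → suc (toℕ v) ≡ toℕ w ⊎ suc (toℕ w) ≡ toℕ v → T (pathGraph n v w)
path-edge {v = v} {w} (inj₁ e) = from (T-∨ {suc (toℕ v) ≡ᵇ toℕ w}) (inj₁ (≡⇒≡ᵇ _ _ e))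
path-edge {v = v} {w} (inj₂ e) = from (T-∨ {suc (toℕ v) ≡ᵇ toℕ w}) (inj₂ (≡⇒≡ᵇ _ _ e))

stripes-220 : ∀ n → Is220 (pathGraph n) (stripes n)
stripes-220 n v le with stripe-gap (phase n) (phase≤1 n) (toℕ v) le
... | inj₁ right≡2 with m≤n⇒m<n∨m≡n (toℕ<n v)
...   | inj₁ v+1<n = 2≤nbhdSum (pathGraph n) (stripes n) (path-edge (inj₁ (sym (toℕ-fromℕ< v+1<n))))
                       (trans (cong (toℕ ∘ stripe (phase n)) (toℕ-fromℕ< v+1<n)) right≡2)
...   | inj₂ v+1≡n = ⊥-elim (0≢1+n (trans (sym (stripe-phase-end n))
                       (trans (cong (toℕ ∘ stripe (phase n)) (sym v+1≡n)) right≡2)))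
stripes-220 n v le | inj₂ (j , j+1≡v , left≡2) =
  2≤nbhdSum (pathGraph n) (stripes n) (path-edge (inj₂ (trans (cong suc (toℕ-fromℕ< j<n)) j+1≡v)))
    (trans (cong (toℕ ∘ stripe (phase n)) (toℕ-fromℕ< j<n)) left≡2)
  where
  j<n : j < n
  j<n = <-trans (subst (j <_) j+1≡v (n<1+n j)) (toℕ<n v)

weight-stripes : ∀ n → weight (stripes n) ≡ 2 * ceil3 n
weight-stripes n = begin
  weight (stripes n)                ≡⟨ weight≡sum-tabulate (stripes n) ⟩
  sum (tabulate (val (stripes n)))  ≡⟨ sum-tabulate≡sumFrom (val (stripes n)) g 0 (λ u → cong g (sym (+-identityʳ (toℕ u)))) ⟩
  sumFrom g 0 n                     ≡⟨ sumFrom-stripe n ⟩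
  2 * ceil3 n                       ∎
  where
  open ≡-Reasoning
  g : ℕ → ℕ
  g = toℕ ∘ stripe (phase n)

path⇒cycle : ∀ {n} {f : Label n} → Is220 (pathGraph n) f → Is220 (cycleGraph n) f
path⇒cycle {n} {f} is220 v le =
  ≤-trans (is220 v le)
    (nbhdSum-mono {G = pathGraph n} {cycleGraph n} f v λ u path-edge → from (T-∨ {pathGraph n v u}) (inj₁ path-edge))

proposition3p32 : (n : ℕ) → 3 ≤ n →
    Gamma220≡ (pathGraph n) (2 * ceil3 n) × Gamma220≡ (cycleGraph n) (2 * ceil3 n)
proposition3p32 n@(suc _) 3≤n =
    ((stripes n , stripes-220 n , weight-stripes n) , λ f is220 → cycle-lower f 3≤n (path⇒cycle is220))
  , ((stripes n , path⇒cycle (stripes-220 n) , weight-stripes n) , λ f → cycle-lower f 3≤n)
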